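{- Let $G$ be an ISK4-free $K_{3,3}$-trigraph. Then $G$ contains no semi-adjacent pairs, i.e. $G$ is a strong $K_{3,3}$.
   Context: A trigraph $G$ is a finite set $V(G)$ with a function $\theta_G$ from 2-element subsets to $\{ -1,0,1\}$; $uv$ is semi-adjacent if $\theta_G(uv)=0$. A realization is a graph on $V(G)$ obtained by turning each semi-adjacent pair into an edge or non-edge (pairs with $\theta=1$ are edges, $\theta=-1$ non-edges); the full realization makes all semi-adjacent pairs edges. For a graph $H$, $G$ is an $H$-trigraph if some realization of $G$ is isomorphic to $H$. $G$ is ISK4-free if no realization of $G$ has an induced subgraph isomorphic to a subdivision of $K_4$. A strong $K_{3,3}$ is a trigraph whose full realization is $K_{3,3}$ and which has no semi-adjacent pairs. -}

module Defs where

open import Data.Nat using (ℕ)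
open import Data.Fin using (Fin; _<_)
open import Data.Fin.Patterns
open import Data.Bool using (Bool; true; false; _xor_)
open import Data.List using (List; []; _∷_; _++_; concat; map)
open import Data.List.Relation.Unary.Unique.Propositional using (Unique)
open import Data.List.Membership.Propositional using (_∈_)
open import Data.Product using (Σ; _×_; ∃; _,_)
open import Data.Sum using (_⊎_)
open import Relation.Binary.PropositionalEquality using (_≡_; _≢_)
open import Relation.Nullary using (¬_)
open import Function.Bundles using (Bijection; _⤖_; _⇔_)
open import Data.Fin.Base using (toℕ)
open import Data.Nat using (_<ᵇ_)

-- values of θ : -1 (strong non-adjacent), 0 (semi-adjacent), 1 (strong adjacent)
data Tri : Set where
  minus1 zero0 plus1 : Tri

-- A trigraph on vertex set Fin n; θ is only meaningful on pairs u ≢ v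
-- (it is a function on 2-element subsets, hence symmetric).
record Trigraph : Set where
  field
    n     : ℕ
    θ     : Fin n → Fin n → Tri
    θ-sym : ∀ u v → θ u v ≡ θ v u
open Trigraph public

-- A (simple) graph on Fin n given by a symmetric adjacency function;
-- only pairs u ≢ v are meaningful.
SymAdj : ℕ → Set
SymAdj n = Σ (Fin n → Fin n → Bool) λ E → ∀ u v → E u v ≡ E v u

SemiAdjacent : (G : Trigraph) → Fin (n G) → Fin (n G) → Set
SemiAdjacent G u v = u ≢ v × θ G u v ≡ zero0

Compatible : (G : Trigraph) → (Fin (n G) → Fin (n G) → Bool) → Set
Compatible G E = ∀ u v → u ≢ v →
  (θ G u v ≡ plus1 → E u v ≡ true) × (θ G u v ≡ minus1 → E u v ≡ false)

Realization : Trigraph → Set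
Realization G = Σ (SymAdj (n G)) λ E → Compatible G (Data.Product.proj₁ E)

fullAdj : (G : Trigraph) → Fin (n G) → Fin (n G) → Bool
fullAdj G u v with θ G u v
... | minus1 = false
... | zero0  = true
... | plus1  = true

K33adj : Fin 6 → Fin 6 → Bool
K33adj x y = (toℕ x <ᵇ 3) xor (toℕ y <ᵇ 3)

IsoK33 : {m : ℕ} → (Fin m → Fin m → Bool) → Set
IsoK33 {m} E = Σ (Fin m ⤖ Fin 6) λ σ →
  ∀ u v → u ≢ v → E u v ≡ K33adj (Bijection.to σ u) (Bijection.to σ v)

IsK33Trigraph : Trigraph → Set
IsK33Trigraph G = Σ (Realization G) λ R → IsoK33 (Data.Product.proj₁ (Data.Product.proj₁ R))

IsStrongK33 : Trigraph → Set
IsStrongK33 G = IsoK33 (fullAdj G) × (∀ u v → ¬ SemiAdjacent G u v)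

data Consec {A : Set} : List A → A → A → Set where
  here  : ∀ {x y xs} → Consec (x ∷ y ∷ xs) x y
  there : ∀ {z x y xs} → Consec xs x y → Consec (z ∷ xs) x y

k4edge : Fin 6 → Fin 4 × Fin 4
k4edge 0F = 0F , 1F
k4edge 1F = 0F , 2F
k4edge 2F = 0F , 3F
k4edge 3F = 1F , 2F
k4edge 4F = 1F , 3F
k4edge 5F = 2F , 3F

-- An induced subgraph of the graph E (on Fin m) that is a subdivision of K4:
-- four branch vertices, and for every edge ij of K4 a list of internal
-- vertices of the path replacing ij; all these vertices are distinct, and
-- two distinct vertices among them are adjacent in E iff they are
-- consecutive on one of the six paths.
record InducedSubdivK4 {m : ℕ} (E : Fin m → Fin m → Bool) : Set where
  field
    branch   : Fin 4 → Fin m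
    internal : Fin 6 → List (Fin m)
  pathSeq : Fin 6 → List (Fin m)
  pathSeq k = branch (Data.Product.proj₁ (k4edge k)) ∷
              (internal k ++ branch (Data.Product.proj₂ (k4edge k)) ∷ [])
  vertices : List (Fin m)
  vertices = (branch 0F ∷ branch 1F ∷ branch 2F ∷ branch 3F ∷ []) ++
             concat (internal 0F ∷ internal 1F ∷ internal 2F ∷
                     internal 3F ∷ internal 4F ∷ internal 5F ∷ [])
  field
    distinct : Unique vertices
    induced  : ∀ x y → x ∈ vertices → y ∈ vertices → x ≢ y →
               (E x y ≡ true) ⇔ (∃ λ k → Consec (pathSeq k) x y ⊎ Consec (pathSeq k) y x)

ISK4Free : Trigraph → Set
ISK4Free G = (R : Realization G) →
  ¬ InducedSubdivK4 (Data.Product.proj₁ (Data.Product.proj₁ R))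

-- Idea. Let R be a realization of G isomorphic to K_{3,3}, and suppose uv
-- is semi-adjacent.  Toggling the single pair uv in R gives another
-- realization R' of G.  Under the isomorphism, R' is K_{3,3} with exactly
-- one pair toggled: either one edge is deleted, or one edge is added inside
-- a side.  Each of these graphs contains an induced subdivision of K4,
-- contradicting ISK4-freeness.  With no semi-adjacent pairs, the full
-- realization coincides with R, so G is a strong K_{3,3}.
module Submission where

open import Defs
open import Data.Unit using (tt)
open import Data.Empty using (⊥-elim)
open import Data.Fin using (Fin; _≟_)
open import Data.Fin.Patterns
open import Data.Fin.Properties using (all?; any?)
open import Data.Bool using (Bool; true; false; _xor_; _∧_; _∨_; if_then_else_)
open import Data.Bool.Properties using (∧-comm; ∨-comm) renaming (_≟_ to _≟ᵇ_)
open import Data.List using (List; []; _∷_; _++_; concat; map)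
open import Data.List.Properties using (map-++; concat-map)
open import Data.List.Relation.Unary.Unique.Propositional using (Unique)
open import Data.List.Relation.Unary.AllPairs using (allPairs?)
import Data.List.Relation.Unary.Unique.Propositional.Properties as Unique
open import Data.List.Membership.Propositional using (_∈_)
open import Data.List.Membership.Propositional.Properties using (∈-map⁻)
import Data.List.Membership.DecPropositional as DecMembership
open import Data.Product using (_×_; ∃; ∃₂; _,_; proj₁; proj₂)
open import Data.Sum using (_⊎_; inj₁; inj₂)
open import Function.Base using (_∘_)
open import Function.Bundles using (_⇔_; _⤖_; mk⇔; Equivalence; Inverse)
open import Function.Definitions using (Injective)
open import Function.Properties.Bijection using (⤖⇒↔)
open import Relation.Binary.PropositionalEquality
  using (_≡_; _≢_; refl; sym; trans; cong; cong₂; subst; subst₂)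
open import Relation.Nullary using (¬_; Dec; yes; no; ¬?)
open import Relation.Nullary.Decidable
  using (⌊_⌋; _→-dec_; _×-dec_; _⊎-dec_; map′; toWitness)

_==_ : ∀ {m} → Fin m → Fin m → Bool
x == y = ⌊ x ≟ y ⌋

isPair : ∀ {m} → Fin m → Fin m → Fin m → Fin m → Bool
isPair u v x y = (x == u ∧ y == v) ∨ (x == v ∧ y == u)

toggle : ∀ {m} → Fin m → Fin m → (Fin m → Fin m → Bool) → Fin m → Fin m → Bool
toggle u v E x y = isPair u v x y xor E x y

isPair-sym : ∀ {m} (u v x y : Fin m) → isPair u v x y ≡ isPair u v y x
isPair-sym u v x y
  rewrite ∧-comm (x == u) (y == v) | ∧-comm (x == v) (y == u)
  = ∨-comm (y == v ∧ x == u) (y == u ∧ x == v)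

isPair-true : ∀ {m} (u v x y : Fin m) → isPair u v x y ≡ true →
              (x ≡ u × y ≡ v) ⊎ (x ≡ v × y ≡ u)
isPair-true u v x y e with x ≟ u | y ≟ v | x ≟ v | y ≟ u
... | yes p | yes q | _     | _     = inj₁ (p , q)
... | _     | _     | yes p | yes q = inj₂ (p , q)
isPair-true u v x y () | no _  | _     | no _  | _
isPair-true u v x y () | no _  | _     | yes _ | no _
isPair-true u v x y () | yes _ | no _  | no _  | _
isPair-true u v x y () | yes _ | no _  | yes _ | no _

==-injective : ∀ {k m} (f : Fin k → Fin m) → Injective _≡_ _≡_ f →
               ∀ x y → f x == f y ≡ x == y
==-injective f inj x y with x ≟ y | f x ≟ f y
... | yes _    | yes _ = refl
... | no _     | no _  = refl
... | yes refl | no q  = ⊥-elim (q refl)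
... | no p     | yes q = ⊥-elim (p (inj q))

isPair-injective : ∀ {k m} (f : Fin k → Fin m) → Injective _≡_ _≡_ f →
                   ∀ a b x y → isPair (f a) (f b) (f x) (f y) ≡ isPair a b x y
isPair-injective f inj a b x y
  rewrite ==-injective f inj x a | ==-injective f inj y b
        | ==-injective f inj x b | ==-injective f inj y a = refl

-- The pair {u, v} is the only one toggled, and θ vanishes on it, so the
-- constraints coming from strong pairs are unaffected.
toggleRealization : (G : Trigraph) {u v : Fin (n G)} → SemiAdjacent G u v →
                    Realization G → Realization G
toggleRealization G {u} {v} (_ , θuv) ((E , E-sym) , compatible) =
  (toggle u v E , toggle-sym) , toggle-compatible
  where
  toggle-sym : ∀ x y → toggle u v E x y ≡ toggle u v E y x
  toggle-sym x y = cong₂ _xor_ (isPair-sym u v x y) (E-sym x y)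

  θ-on-pair : ∀ x y → isPair u v x y ≡ true → θ G x y ≡ zero0
  θ-on-pair x y e with isPair-true u v x y e
  ... | inj₁ (refl , refl) = θuv
  ... | inj₂ (refl , refl) = trans (θ-sym G v u) θuv

  toggle-compatible : Compatible G (toggle u v E)
  toggle-compatible x y x≢y with isPair u v x y in e
  ... | false = compatible x y x≢y
  ... | true rewrite θ-on-pair x y e = (λ ()) , (λ ())

subdivVertices : ∀ {m} → (Fin 4 → Fin m) → (Fin 6 → List (Fin m)) → List (Fin m)
subdivVertices B I = (B 0F ∷ B 1F ∷ B 2F ∷ B 3F ∷ []) ++
                     concat (I 0F ∷ I 1F ∷ I 2F ∷ I 3F ∷ I 4F ∷ I 5F ∷ [])

subdivPath : ∀ {m} → (Fin 4 → Fin m) → (Fin 6 → List (Fin m)) → Fin 6 → List (Fin m)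
subdivPath B I k = B (proj₁ (k4edge k)) ∷ (I k ++ B (proj₂ (k4edge k)) ∷ [])

OnPath : ∀ {m} → (Fin 4 → Fin m) → (Fin 6 → List (Fin m)) → Fin m → Fin m → Set
OnPath B I x y = ∃ λ k → Consec (subdivPath B I k) x y ⊎ Consec (subdivPath B I k) y x

IsInduced : ∀ {m} → (Fin m → Fin m → Bool) →
            (Fin 4 → Fin m) → (Fin 6 → List (Fin m)) → Set
IsInduced E B I = ∀ x y → x ∈ subdivVertices B I → y ∈ subdivVertices B I → x ≢ y →
                  (E x y ≡ true) ⇔ OnPath B I x y

IsSubdivision : ∀ {m} → (Fin m → Fin m → Bool) →
                (Fin 4 → Fin m) → (Fin 6 → List (Fin m)) → Set
IsSubdivision E B I = Unique (subdivVertices B I) × IsInduced E B I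

InducedEmbedding : ∀ {k m} → (Fin k → Fin k → Bool) → (Fin m → Fin m → Bool) →
                   (Fin k → Fin m) → Set
InducedEmbedding F E f = Injective _≡_ _≡_ f × (∀ x y → x ≢ y → E (f x) (f y) ≡ F x y)

Consec-map⁺ : ∀ {A B : Set} (f : A → B) {l x y} →
              Consec l x y → Consec (map f l) (f x) (f y)
Consec-map⁺ f here      = here
Consec-map⁺ f (there c) = there (Consec-map⁺ f c)

Consec-map⁻ : ∀ {A B : Set} (f : A → B) l {x′ y′} → Consec (map f l) x′ y′ →
              ∃₂ λ x y → Consec l x y × f x ≡ x′ × f y ≡ y′
Consec-map⁻ f []          ()
Consec-map⁻ f (x ∷ y ∷ l) here      = x , y , here , refl , refl
Consec-map⁻ f (z ∷ l)     (there c) with Consec-map⁻ f l c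
... | x , y , c′ , p , q = x , y , there c′ , p , q

Consec-map-injective : ∀ {A B : Set} (f : A → B) → Injective _≡_ _≡_ f →
                       ∀ l {x y} → Consec (map f l) (f x) (f y) → Consec l x y
Consec-map-injective f inj l c with Consec-map⁻ f l c
... | x , y , c′ , p , q = subst₂ (Consec l) (inj p) (inj q) c′

module Relabel {k m} (f : Fin k → Fin m) (B : Fin 4 → Fin k) (I : Fin 6 → List (Fin k)) where
  B′ : Fin 4 → Fin m
  B′ = f ∘ B

  I′ : Fin 6 → List (Fin m)
  I′ = map f ∘ I

  vertices-map : subdivVertices B′ I′ ≡ map f (subdivVertices B I)
  vertices-map = cong (λ t → f (B 0F) ∷ f (B 1F) ∷ f (B 2F) ∷ f (B 3F) ∷ t)
                      (concat-map (I 0F ∷ I 1F ∷ I 2F ∷ I 3F ∷ I 4F ∷ I 5F ∷ []))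

  path-map : ∀ j → subdivPath B′ I′ j ≡ map f (subdivPath B I j)
  path-map j = cong (f (B (proj₁ (k4edge j))) ∷_) (sym (map-++ f (I j) (B (proj₂ (k4edge j)) ∷ [])))

  OnPath-map : Injective _≡_ _≡_ f → ∀ x y → OnPath B′ I′ (f x) (f y) ⇔ OnPath B I x y
  OnPath-map inj x y = mk⇔ reflect preserve
    where
    consec⁺ : ∀ j {a b} → Consec (subdivPath B I j) a b → Consec (subdivPath B′ I′ j) (f a) (f b)
    consec⁺ j {a} {b} c = subst (λ l → Consec l (f a) (f b)) (sym (path-map j)) (Consec-map⁺ f c)
    consec⁻ : ∀ j {a b} → Consec (subdivPath B′ I′ j) (f a) (f b) → Consec (subdivPath B I j) a b
    consec⁻ j {a} {b} c =
      Consec-map-injective f inj (subdivPath B I j) (subst (λ l → Consec l (f a) (f b)) (path-map j) c)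
    reflect : OnPath B′ I′ (f x) (f y) → OnPath B I x y
    reflect (j , inj₁ c) = j , inj₁ (consec⁻ j c)
    reflect (j , inj₂ c) = j , inj₂ (consec⁻ j c)
    preserve : OnPath B I x y → OnPath B′ I′ (f x) (f y)
    preserve (j , inj₁ c) = j , inj₁ (consec⁺ j c)
    preserve (j , inj₂ c) = j , inj₂ (consec⁺ j c)

embedSubdivision : ∀ {k m} {F : Fin k → Fin k → Bool} {E : Fin m → Fin m → Bool}
                   (f : Fin k → Fin m) → InducedEmbedding F E f →
                   ∀ B I → IsSubdivision F B I → InducedSubdivK4 E
embedSubdivision {E = E} f (inj , edges) B I (distinct , induced) = record
  { branch   = B′
  ; internal = I′
  ; distinct = subst Unique (sym vertices-map) (Unique.map⁺ inj distinct)
  ; induced  = induced′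
  }
  where
  open Relabel f B I

  induced′ : IsInduced E B′ I′
  induced′ x′ y′ x′∈ y′∈ x′≢y′
    with ∈-map⁻ f (subst (x′ ∈_) vertices-map x′∈) | ∈-map⁻ f (subst (y′ ∈_) vertices-map y′∈)
  ... | x , x∈ , refl | y , y∈ , refl = mk⇔
    (λ e → Equivalence.from (OnPath-map inj x y)
             (Equivalence.to (induced x y x∈ y∈ x≢y) (trans (sym (edges x y x≢y)) e)))
    (λ p → trans (edges x y x≢y)
             (Equivalence.from (induced x y x∈ y∈ x≢y) (Equivalence.to (OnPath-map inj x y) p)))
    where
    x≢y : x ≢ y
    x≢y = x′≢y′ ∘ cong f

toggleEmbedding : ∀ {k m} {F : Fin k → Fin k → Bool} {E : Fin m → Fin m → Bool}
                  (f : Fin k → Fin m) → InducedEmbedding F E f → ∀ a b →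
                  InducedEmbedding (toggle a b F) (toggle (f a) (f b) E) f
toggleEmbedding f (inj , edges) a b =
  inj , λ x y x≢y → cong₂ _xor_ (isPair-injective f inj a b x y) (edges x y x≢y)

Consec? : ∀ {m} (l : List (Fin m)) (x y : Fin m) → Dec (Consec l x y)
Consec? []           x y = no λ ()
Consec? (z ∷ [])     x y = no λ { (there ()) }
Consec? (z ∷ w ∷ l) x y with z ≟ x | w ≟ y | Consec? (w ∷ l) x y
... | yes refl | yes refl | _      = yes here
... | _        | _        | yes c  = yes (there c)
... | no z≢x   | _        | no ¬c  = no λ { here → z≢x refl ; (there c) → ¬c c }
... | yes _    | no w≢y   | no ¬c  = no λ { here → w≢y refl ; (there c) → ¬c c }

_⇔?_ : ∀ {A B : Set} → Dec A → Dec B → Dec (A ⇔ B)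
a? ⇔? b? = map′ (λ (f , g) → mk⇔ f g) (λ e → Equivalence.to e , Equivalence.from e)
                ((a? →-dec b?) ×-dec (b? →-dec a?))

IsInduced? : ∀ {m} (E : Fin m → Fin m → Bool) B I → Dec (IsInduced E B I)
IsInduced? E B I = all? λ x → all? λ y →
  (x ∈? subdivVertices B I) →-dec (y ∈? subdivVertices B I) →-dec ¬? (x ≟ y) →-dec
  ((E x y ≟ᵇ true) ⇔? any? (λ k → Consec? (subdivPath B I k) x y ⊎-dec Consec? (subdivPath B I k) y x))
  where open DecMembership _≟_ using (_∈?_)

-- In K_{3,3} (sides {0,1,2} and {3,4,5}): the two other vertices on the
-- side of a, and two fixed vertices on the opposite side.
sibling₁ sibling₂ opposite₁ opposite₂ : Fin 6 → Fin 6
sibling₁ 0F = 1F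
sibling₁ 1F = 0F
sibling₁ 2F = 0F
sibling₁ 3F = 4F
sibling₁ 4F = 3F
sibling₁ 5F = 3F
sibling₂ 0F = 2F
sibling₂ 1F = 2F
sibling₂ 2F = 1F
sibling₂ 3F = 5F
sibling₂ 4F = 5F
sibling₂ 5F = 4F
opposite₁ 0F = 3F
opposite₁ 1F = 3F
opposite₁ 2F = 3F
opposite₁ _  = 0F
opposite₂ 0F = 4F
opposite₂ 1F = 4F
opposite₂ 2F = 4F
opposite₂ _  = 1F

-- The subdivision of K4 in K_{3,3} with the pair ab toggled.
--  * ab an edge (deleted): branch vertices are the siblings a₁ a₂ of a and
--    b₁ b₂ of b; the four cross edges are paths, a₁–a₂ runs through b and
--    b₁–b₂ through a.
--  * ab a non-edge (added): branch vertices a, b, c₁, c₂ with c₁ c₂ on the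
--    opposite side; a–b is the new edge and c₁–c₂ runs through the third
--    vertex of the side of a.
toggleBranch : Fin 6 → Fin 6 → Fin 4 → Fin 6
toggleBranch a b = if K33adj a b then deleted else added
  where
  deleted added : Fin 4 → Fin 6
  deleted 0F = sibling₁ a
  deleted 1F = sibling₂ a
  deleted 2F = sibling₁ b
  deleted 3F = sibling₂ b
  added 0F = a
  added 1F = b
  added 2F = opposite₁ a
  added 3F = opposite₂ a

toggleInterior : Fin 6 → Fin 6 → Fin 6 → List (Fin 6)
toggleInterior a b 0F = if K33adj a b then b ∷ [] else []
toggleInterior a b 5F = if K33adj a b then a ∷ [] else third ∷ []
  where
  third : Fin 6
  third = if b == sibling₁ a then sibling₂ a else sibling₁ a
toggleInterior a b _  = []

-- Exhaustive check over the 30 ordered pairs of distinct vertices.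
toggleK33-subdivision : ∀ a b → a ≢ b →
  IsSubdivision (toggle a b K33adj) (toggleBranch a b) (toggleInterior a b)
toggleK33-subdivision = toWitness {a? = all? λ a → all? λ b → ¬? (a ≟ b) →-dec
  (allPairs? (λ x y → ¬? (x ≟ y)) (subdivVertices (toggleBranch a b) (toggleInterior a b))
   ×-dec IsInduced? (toggle a b K33adj) (toggleBranch a b) (toggleInterior a b))} tt

isoInverseEmbedding : ∀ {k m} {E : Fin m → Fin m → Bool} {F : Fin k → Fin k → Bool}
  (σ : Fin m ⤖ Fin k) → let open Inverse (⤖⇒↔ σ) in
  (∀ u v → u ≢ v → E u v ≡ F (to u) (to v)) → InducedEmbedding F E from
isoInverseEmbedding {E = E} {F} σ iso = from-injective , edges
  where
  open Inverse (⤖⇒↔ σ)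

  from-injective : Injective _≡_ _≡_ from
  from-injective {x} {y} e =
    trans (sym (strictlyInverseˡ x)) (trans (cong to e) (strictlyInverseˡ y))

  edges : ∀ x y → x ≢ y → E (from x) (from y) ≡ F x y
  edges x y x≢y = trans (iso (from x) (from y) (x≢y ∘ from-injective))
                        (cong₂ F (strictlyInverseˡ x) (strictlyInverseˡ y))

full-realization : (G : Trigraph) → (∀ u v → ¬ SemiAdjacent G u v) →
                   (R : Realization G) → ∀ x y → x ≢ y →
                   fullAdj G x y ≡ proj₁ (proj₁ R) x y
full-realization G noSemi (_ , compatible) x y x≢y with θ G x y in e
... | minus1 = sym (proj₂ (compatible x y x≢y) e)
... | zero0  = ⊥-elim (noSemi x y (x≢y , e))
... | plus1  = sym (proj₁ (compatible x y x≢y) e)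

-- If uv were semi-adjacent, toggling it in the K_{3,3} realization R gives
-- a realization into which K_{3,3} with the pair (σ u)(σ v) toggled embeds
-- as an induced subgraph; that graph contains an induced subdivision of K4.
proposition4p13 : (G : Trigraph) → ISK4Free G → IsK33Trigraph G →
    (∀ u v → ¬ SemiAdjacent G u v) × IsStrongK33 G
proposition4p13 G isk4Free (R , σ , iso) = noSemi , (σ , fullIso) , noSemi
  where
  open Inverse (⤖⇒↔ σ) using (to; from; strictlyInverseʳ)

  E : Fin (n G) → Fin (n G) → Bool
  E = proj₁ (proj₁ R)

  K33↪R : InducedEmbedding K33adj E from
  K33↪R = isoInverseEmbedding σ iso

  noSemi : ∀ u v → ¬ SemiAdjacent G u v
  noSemi u v semi = isk4Free (toggleRealization G semi′ R)
    (embedSubdivision from (toggleEmbedding {E = E} from K33↪R a b)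
      (toggleBranch a b) (toggleInterior a b) (toggleK33-subdivision a b a≢b))
    where
    a b : Fin 6
    a = to u
    b = to v
    semi′ : SemiAdjacent G (from a) (from b)
    semi′ = subst₂ (SemiAdjacent G) (sym (strictlyInverseʳ u)) (sym (strictlyInverseʳ v)) semi
    a≢b : a ≢ b
    a≢b e = proj₁ semi (trans (sym (strictlyInverseʳ u)) (trans (cong from e) (strictlyInverseʳ v)))

  fullIso : ∀ x y → x ≢ y → fullAdj G x y ≡ K33adj (to x) (to y)
  fullIso x y x≢y = trans (full-realization G noSemi R x y x≢y) (iso x y x≢y)
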